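{- For all integers $0<m\le x$, $\mu(P_m,P_x)=(-1)^{x-m}$.
   Context: $\mathcal{G}$ is the poset of all finite unlabelled graphs (loops and multiple edges allowed), up to isomorphism, with $H\le G$ iff $H$ is isomorphic to an induced subgraph of $G$; $\mu$ is its Möbius function ($\mu(a,a)=1$, $\mu(a,b)=0$ if $a\not\le b$, $\mu(a,b)=-\sum_{a\le c<b}\mu(a,c)$ if $a<b$). $P_a$ is the path graph with $a$ vertices. -}

module Defs where

open import Data.Nat using (ℕ; zero; suc)
open import Data.Fin using (Fin; toℕ)
open import Data.Integer as ℤ using (ℤ)
open import Data.List using (List; map; foldr)
open import Data.List.Membership.Propositional using (_∈_)
open import Data.List.Relation.Unary.Any using (Any)
open import Data.List.Relation.Unary.AllPairs using (AllPairs)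
open import Data.Product using (Σ; _×_; ∃)
open import Function.Definitions using (Injective)
open import Relation.Binary.PropositionalEquality using (_≡_)
open import Relation.Nullary using (¬_)

-- A finite graph with loops and multiple edges allowed:
-- vertex set Fin size, adj i j = number of edges between i and j
-- (adj i i = number of loops at i); adjacency is symmetric.
record Graph : Set where
  field
    size : ℕ
    adj  : Fin size → Fin size → ℕ
    sym  : ∀ i j → adj i j ≡ adj j i
open Graph public

record _≤G_ (H G : Graph) : Set where
  field
    emb      : Fin (size H) → Fin (size G)
    emb-inj  : Injective _≡_ _≡_ emb
    emb-adj  : ∀ i j → adj H i j ≡ adj G (emb i) (emb j)

record _≅G_ (H G : Graph) : Set where
  field
    to      : Fin (size H) → Fin (size G)
    from    : Fin (size G) → Fin (size H)
    to-from : ∀ j → to (from j) ≡ j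
    from-to : ∀ i → from (to i) ≡ i
    to-adj  : ∀ i j → adj H i j ≡ adj G (to i) (to j)

_<G_ : Graph → Graph → Set
H <G G = (H ≤G G) × ¬ (H ≅G G)

pathAdj : ℕ → ℕ → ℕ
pathAdj zero zero = 0
pathAdj zero (suc zero) = 1
pathAdj zero (suc (suc b)) = 0
pathAdj (suc a) (suc b) = pathAdj a b
pathAdj (suc zero) zero = 1
pathAdj (suc (suc a)) zero = 0

pathAdj-sym : ∀ a b → pathAdj a b ≡ pathAdj b a
pathAdj-sym zero zero = _≡_.refl
pathAdj-sym zero (suc zero) = _≡_.refl
pathAdj-sym zero (suc (suc b)) = _≡_.refl
pathAdj-sym (suc zero) zero = _≡_.refl
pathAdj-sym (suc (suc a)) zero = _≡_.refl
pathAdj-sym (suc a) (suc b) = pathAdj-sym a b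

P : ℕ → Graph
P a = record { size = a ; adj = λ i j → pathAdj (toℕ i) (toℕ j)
             ; sym = λ i j → pathAdj-sym (toℕ i) (toℕ j) }

IsIntervalReps : Graph → Graph → List Graph → Set
IsIntervalReps a b L =
  (∀ {c} → c ∈ L → (a ≤G c) × (c <G b)) ×
  (∀ c → a ≤G c → c <G b → Any (c ≅G_) L) ×
  AllPairs (λ d e → ¬ (d ≅G e)) L

-- The defining recursion of the Möbius function of the poset 𝒢,
-- read on representatives of isomorphism classes.
IsMobius : (Graph → Graph → ℤ) → Set
IsMobius μ =
  (∀ a b → a ≅G b → μ a b ≡ ℤ.1ℤ) ×
  (∀ a b → ¬ (a ≤G b) → μ a b ≡ ℤ.0ℤ) ×
  (∀ a b → a <G b → ∀ L → IsIntervalReps a b L → μ a b ≡ ℤ.- foldr ℤ._+_ ℤ.0ℤ (map (μ a) L))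

-- For a graph c that embeds in a path (so c is a disjoint union of paths) and contains P m, we show
-- by induction on its size that μ (P m) c is (-1)^(k-m) if c ≅ P k, -(-1)^(k-m) if c ≅ P k ∪ K₁
-- with k ≥ 1, and 0 otherwise. The Möbius recursion sums these values over the interval [P m, c);
-- adding the value at c itself turns the sum into Σ_k (-1)^(k-m) ([P k ≤ c] - [P k ∪ K₁ ≤ c]).
-- If M is the number of vertices of a longest path in c, then P k ≤ c iff k ≤ M, while
-- P k ∪ K₁ ≤ c iff k + 2 ≤ M, or k ≤ M and c is not itself a path. So the two indicator sums agree
-- when c is not a path, and when c ≅ P M with M > m they differ by the signs at k = M - 1 and
-- k = M, which cancel. The closed sum therefore vanishes, which is the recursion for these values.

module Submission where

open import Defs hiding (sym)
open import Data.Nat using (ℕ; _<_; _≤_; _∸_)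
open import Data.Integer using (ℤ; -1ℤ; _^_)
open import Relation.Binary.PropositionalEquality using (_≡_)

open import Data.Fin as Fin using (Fin; toℕ; punchOut)
open import Data.Fin.Properties
  using (any?; all?; injective⇒≤; punchOut-injective; suc-injective; 0≢1+n; toℕ-injective; toℕ<n
        ; toℕ-inject≤; toℕ-inject₁; toℕ-fromℕ<; ¬∀⟶∃¬)
open import Data.Integer using (0ℤ; 1ℤ)
import Data.Integer.Properties as ℤ
open import Algebra.Properties.AbelianGroup ℤ.+-0-abelianGroup using (inverseˡ-unique)
open import Algebra.Properties.CommutativeMonoid.Sum ℤ.+-0-commutativeMonoid
  using (sum; sum⁺-syntax; ∑-distrib-+; sum-cong-≗; sum-replicate-zero)
open import Data.Integer.Tactic.RingSolver using (solve-∀)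
open import Data.List using (List; []; _∷_; map; foldr; concatMap; upTo; allFin; filter; deduplicate; cartesianProductWith)
open import Data.List.Membership.Propositional using (_∈_; find)
import Data.List.Relation.Unary.All as All
import Data.List.Relation.Unary.All.Properties as All
open import Data.List.Relation.Unary.AllPairs using (AllPairs; []; _∷_)
open import Data.List.Relation.Unary.Any as Any using (Any; here; there)
import Data.List.Relation.Unary.Any.Properties as Any
open import Data.List.Relation.Unary.Unique.DecSetoid.Properties using (deduplicate-!)
open import Data.Nat as ℕ using (zero; suc; z≤n; s≤s)
import Data.Nat.Induction as ℕ
import Data.Nat.Properties as ℕ
open import Data.Product using (_×_; ∃; _,_; proj₁; proj₂)
open import Data.Sum as Sum using (_⊎_; inj₁; inj₂)
import Data.Vec.Functional as Vector
open import Function using (_∘_; id)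
open import Function.Definitions using (Injective)
import Induction.WellFounded as WF
open import Relation.Binary.Bundles using (DecSetoid)
import Relation.Binary.Construct.On as On
open import Relation.Binary.PropositionalEquality
open import Relation.Nullary using (¬_; Dec; yes; no; contradiction)
open import Relation.Nullary.Decidable using (map′; _×-dec_; _→-dec_; ¬?)

open _≤G_
open _≅G_

≤G-refl : ∀ a → a ≤G a
≤G-refl a = record { emb = id ; emb-inj = id ; emb-adj = λ _ _ → refl }

≤G-trans : ∀ {a b c} → a ≤G b → b ≤G c → a ≤G c
≤G-trans p q = record
  { emb = emb q ∘ emb p
  ; emb-inj = emb-inj p ∘ emb-inj q
  ; emb-adj = λ i j → trans (emb-adj p i j) (emb-adj q (emb p i) (emb p j)) }

≅G-refl : ∀ a → a ≅G a
≅G-refl a = record { to = id ; from = id ; to-from = λ _ → refl ; from-to = λ _ → refl ; to-adj = λ _ _ → refl }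

≅G-sym : ∀ {a b} → a ≅G b → b ≅G a
≅G-sym {b = b} p = record
  { to = from p ; from = to p ; to-from = from-to p ; from-to = to-from p
  ; to-adj = λ i j → sym (trans (to-adj p (from p i) (from p j)) (cong₂ (adj b) (to-from p i) (to-from p j))) }

≅G-trans : ∀ {a b c} → a ≅G b → b ≅G c → a ≅G c
≅G-trans p q = record
  { to = to q ∘ to p ; from = from p ∘ from q
  ; to-from = λ j → trans (cong (to q) (to-from p (from q j))) (to-from q j)
  ; from-to = λ i → trans (cong (from p) (from-to q (to p i))) (from-to p i)
  ; to-adj = λ i j → trans (to-adj p i j) (to-adj q (to p i) (to p j)) }

≅G⇒≤G : ∀ {a b} → a ≅G b → a ≤G b
≅G⇒≤G p = record
  { emb = to p
  ; emb-inj = λ {x} {y} e → trans (sym (from-to p x)) (trans (cong (from p) e) (from-to p y))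
  ; emb-adj = to-adj p }

size-mono : ∀ {a b} → a ≤G b → size a ≤ size b
size-mono p = injective⇒≤ (emb-inj p)

size-≅G : ∀ {a b} → a ≅G b → size a ≡ size b
size-≅G p = ℕ.≤-antisym (size-mono (≅G⇒≤G p)) (size-mono (≅G⇒≤G (≅G-sym p)))

injective⇒surjective : ∀ {n} (f : Fin n → Fin n) → Injective _≡_ _≡_ f → ∀ j → ∃ λ i → f i ≡ j
injective⇒surjective {suc n} f f-inj j with any? (λ i → f i Fin.≟ j)
... | yes hit = hit
... | no miss = contradiction (injective⇒≤ squeeze-inj) ℕ.1+n≰n
  where
  avoids : ∀ i → j ≢ f i
  avoids i e = miss (i , sym e)
  squeeze : Fin (suc n) → Fin n
  squeeze i = punchOut (avoids i)
  squeeze-inj : Injective _≡_ _≡_ squeeze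
  squeeze-inj {x} {y} e = f-inj (punchOut-injective (avoids x) (avoids y) e)

≤G∧size≡⇒≅G : ∀ {a b} → a ≤G b → size a ≡ size b → a ≅G b
≤G∧size≡⇒≅G {a} {b} p refl = record
  { to = emb p ; from = proj₁ ∘ onto ; to-from = proj₂ ∘ onto
  ; from-to = λ i → emb-inj p (proj₂ (onto (emb p i))) ; to-adj = emb-adj p }
  where onto = injective⇒surjective (emb p) (emb-inj p)

<G⇒size< : ∀ {a b} → a <G b → size a < size b
<G⇒size< {a} {b} (p , a≇b) with size a ℕ.≟ size b
... | yes a≡b = contradiction (≤G∧size≡⇒≅G p a≡b) a≇b
... | no a≢b = ℕ.≤∧≢⇒< (size-mono p) a≢b

-- Deciding ≤G and ≅G by enumerating vertex maps

allFunctions : ∀ k n → List (Fin k → Fin n)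
allFunctions zero n = (λ ()) ∷ []
allFunctions (suc k) n = cartesianProductWith Vector._∷_ (allFin n) (allFunctions k n)

allFunctions-complete : ∀ {k n} (f : Fin k → Fin n) → Any (_≗ f) (allFunctions k n)
allFunctions-complete {zero} f = here (λ ())
allFunctions-complete {suc k} f =
  Any.cartesianProductWith⁺ Vector._∷_ {P = _≡ f Fin.zero} extend
    (Any.tabulate⁺ {P = _≡ f Fin.zero} (f Fin.zero) refl) (allFunctions-complete (f ∘ Fin.suc))
  where
  extend : ∀ {x g} → x ≡ f Fin.zero → g ≗ f ∘ Fin.suc → (x Vector.∷ g) ≗ f
  extend x≡ g≗ Fin.zero = x≡
  extend x≡ g≗ (Fin.suc i) = g≗ i

IsEmbedding : (a b : Graph) → (Fin (size a) → Fin (size b)) → Set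
IsEmbedding a b f = Injective _≡_ _≡_ f × (∀ i j → adj a i j ≡ adj b (f i) (f j))

isEmbedding? : ∀ a b f → Dec (IsEmbedding a b f)
isEmbedding? a b f = injective? ×-dec all? (λ i → all? (λ j → adj a i j ℕ.≟ adj b (f i) (f j)))
  where
  injective? : Dec (Injective _≡_ _≡_ f)
  injective? = map′ (λ h {x} {y} → h x y) (λ h x y → h {x} {y})
                    (all? (λ x → all? (λ y → (f x Fin.≟ f y) →-dec (x Fin.≟ y))))

isEmbedding-resp-≗ : ∀ {a b f g} → f ≗ g → IsEmbedding a b f → IsEmbedding a b g
isEmbedding-resp-≗ {b = b} f≗g (f-inj , f-adj) =
  (λ {x} {y} e → f-inj (trans (f≗g x) (trans e (sym (f≗g y)))))
  , λ i j → trans (f-adj i j) (cong₂ (adj b) (f≗g i) (f≗g j))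

embedding : ∀ {a b} → ∃ (IsEmbedding a b) → a ≤G b
embedding (f , f-inj , f-adj) = record { emb = f ; emb-inj = f-inj ; emb-adj = f-adj }

_≤G?_ : ∀ a b → Dec (a ≤G b)
a ≤G? b = map′
  (embedding ∘ Any.satisfied)
  (λ p → Any.map (λ g≗ → isEmbedding-resp-≗ {a} {b} (sym ∘ g≗) (emb-inj p , emb-adj p)) (allFunctions-complete (emb p)))
  (Any.any? (isEmbedding? a b) (allFunctions (size a) (size b)))

_≅G?_ : ∀ a b → Dec (a ≅G b)
a ≅G? b with a ≤G? b | size a ℕ.≟ size b
... | yes p | yes same = yes (≤G∧size≡⇒≅G p same)
... | no a≰b | _ = no (a≰b ∘ ≅G⇒≤G)
... | _ | no differ = no (differ ∘ size-≅G)

_<G?_ : ∀ a b → Dec (a <G b)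
a <G? b = a ≤G? b ×-dec ¬? (a ≅G? b)

reindex : (b : Graph) {k : ℕ} → (Fin k → Fin (size b)) → Graph
reindex b {k} f = record
  { size = k ; adj = λ i j → adj b (f i) (f j) ; sym = λ i j → Graph.sym b (f i) (f j) }

reindexings : Graph → List Graph
reindexings b = concatMap (λ k → map (reindex b) (allFunctions k (size b))) (upTo (suc (size b)))

reindexings-complete : ∀ {b c} → c ≤G b → Any (c ≅G_) (reindexings b)
reindexings-complete {b} {c} p =
  Any.concatMap⁺ (λ k → map (reindex b) (allFunctions k (size b))) (Any.applyUpTo⁺ id
    (Any.map⁺ (Any.map reindexed (allFunctions-complete (emb p)))) (s≤s (size-mono p)))
  where
  reindexed : ∀ {g} → g ≗ emb p → c ≅G reindex b g
  reindexed g≗ = record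
    { to = id ; from = id ; to-from = λ _ → refl ; from-to = λ _ → refl
    ; to-adj = λ i j → trans (emb-adj p i j) (sym (cong₂ (adj b) (g≗ i) (g≗ j))) }

≅G-decSetoid : DecSetoid _ _
≅G-decSetoid = record
  { Carrier = Graph ; _≈_ = _≅G_
  ; isDecEquivalence = record
    { isEquivalence = record { refl = ≅G-refl _ ; sym = ≅G-sym ; trans = ≅G-trans }
    ; _≟_ = _≅G?_ } }

InInterval : Graph → Graph → Graph → Set
InInterval a b c = (a ≤G c) × (c <G b)

inInterval? : ∀ a b c → Dec (InInterval a b c)
inInterval? a b c = a ≤G? c ×-dec c <G? b

InInterval-resp-≅G : ∀ {a b c d} → c ≅G d → InInterval a b c → InInterval a b d
InInterval-resp-≅G c≅d (a≤c , c≤b , c≇b) =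
  ≤G-trans a≤c (≅G⇒≤G c≅d) , ≤G-trans (≅G⇒≤G (≅G-sym c≅d)) c≤b , c≇b ∘ ≅G-trans c≅d

intervalReps : Graph → Graph → List Graph
intervalReps a b = deduplicate _≅G?_ (filter (inInterval? a b) (reindexings b))

intervalReps-correct : ∀ a b → IsIntervalReps a b (intervalReps a b)
intervalReps-correct a b =
    All.lookup (All.deduplicate⁺ _≅G?_ (All.all-filter (inInterval? a b) (reindexings b)))
  , covered
  , deduplicate-! ≅G-decSetoid _
  where
  candidate : ∀ {c} → a ≤G c → c <G b → Any (λ g → c ≅G g × InInterval a b g) (reindexings b)
  candidate a≤c c<b = Any.map (λ c≅g → c≅g , InInterval-resp-≅G c≅g (a≤c , c<b)) (reindexings-complete (proj₁ c<b))
  covered : ∀ c → a ≤G c → c <G b → Any (c ≅G_) (intervalReps a b)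
  covered c a≤c c<b with Any.filter⁺ (inInterval? a b) (candidate a≤c c<b)
  ... | inj₁ kept = Any.deduplicate⁺ _≅G?_ (λ y≅x c≅x → ≅G-trans c≅x (≅G-sym y≅x)) (Any.map proj₁ kept)
  ... | inj₂ dropped = contradiction (proj₂ (Any.lookup-result (candidate a≤c c<b))) dropped

module Paths where

  open import Data.Nat using (_+_)

  pathAdj-shift : ∀ a i j → pathAdj (a + i) (a + j) ≡ pathAdj i j
  pathAdj-shift zero i j = refl
  pathAdj-shift (suc a) i j = pathAdj-shift a i j

  pathAdj-suc : ∀ i → pathAdj i (suc i) ≡ 1
  pathAdj-suc zero = refl
  pathAdj-suc (suc i) = pathAdj-suc i

  pathAdj-far : ∀ {i j} → suc i < j → pathAdj i j ≡ 0
  pathAdj-far {zero} {suc zero} (s≤s ())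
  pathAdj-far {zero} {suc (suc j)} _ = refl
  pathAdj-far {suc i} {suc j} (s≤s i+1<j) = pathAdj-far i+1<j

  pathAdj-diag : ∀ i → pathAdj i i ≡ 0
  pathAdj-diag zero = refl
  pathAdj-diag (suc i) = pathAdj-diag i

  pathAdj≡1 : ∀ i j → pathAdj i j ≡ 1 → suc i ≡ j ⊎ suc j ≡ i
  pathAdj≡1 zero (suc zero) _ = inj₁ refl
  pathAdj≡1 (suc zero) zero _ = inj₂ refl
  pathAdj≡1 (suc i) (suc j) e with pathAdj≡1 i j e
  ... | inj₁ i+1≡j = inj₁ (cong suc i+1≡j)
  ... | inj₂ j+1≡i = inj₂ (cong suc j+1≡i)

  P-mono : ∀ {m k} → m ≤ k → P m ≤G P k
  P-mono m≤k = record
    { emb = λ i → Fin.inject≤ i m≤k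
    ; emb-inj = λ {x} {y} e → toℕ-injective (trans (sym (toℕ-inject≤ x m≤k)) (trans (cong toℕ e) (toℕ-inject≤ y m≤k)))
    ; emb-adj = λ i j → sym (cong₂ pathAdj (toℕ-inject≤ i m≤k) (toℕ-inject≤ j m≤k)) }

  P0≤ : ∀ c → P 0 ≤G c
  P0≤ c = record { emb = λ () ; emb-inj = λ { {()} } ; emb-adj = λ () }

  P∪K₁ : ℕ → Graph
  P∪K₁ k = record { size = suc k ; adj = adjacency ; sym = adjacency-sym }
    where
    adjacency : Fin (suc k) → Fin (suc k) → ℕ
    adjacency (Fin.suc i) (Fin.suc j) = pathAdj (toℕ i) (toℕ j)
    adjacency _ _ = 0
    adjacency-sym : ∀ i j → adjacency i j ≡ adjacency j i
    adjacency-sym Fin.zero Fin.zero = refl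
    adjacency-sym Fin.zero (Fin.suc j) = refl
    adjacency-sym (Fin.suc i) Fin.zero = refl
    adjacency-sym (Fin.suc i) (Fin.suc j) = pathAdj-sym (toℕ i) (toℕ j)

  P≤P∪K₁ : ∀ k → P k ≤G P∪K₁ k
  P≤P∪K₁ k = record { emb = Fin.suc ; emb-inj = suc-injective ; emb-adj = λ _ _ → refl }

  P∪K₁≤P : ∀ k → P∪K₁ k ≤G P (2 + k)
  P∪K₁≤P k = record { emb = skip ; emb-inj = skip-inj ; emb-adj = skip-adj }
    where
    skip : Fin (suc k) → Fin (2 + k)
    skip Fin.zero = Fin.zero
    skip (Fin.suc i) = Fin.suc (Fin.suc i)
    skip-inj : Injective _≡_ _≡_ skip
    skip-inj {Fin.zero} {Fin.zero} _ = refl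
    skip-inj {Fin.suc i} {Fin.suc j} refl = refl
    skip-adj : ∀ i j → adj (P∪K₁ k) i j ≡ adj (P (2 + k)) (skip i) (skip j)
    skip-adj Fin.zero Fin.zero = refl
    skip-adj Fin.zero (Fin.suc j) = refl
    skip-adj (Fin.suc i) Fin.zero = refl
    skip-adj (Fin.suc i) (Fin.suc j) = refl

  path-neighbour : ∀ {k} (v : Fin (suc (suc k))) → ∃ λ (w : Fin (suc (suc k))) → pathAdj (toℕ v) (toℕ w) ≡ 1
  path-neighbour {k} Fin.zero = Fin.suc Fin.zero , refl
  path-neighbour (Fin.suc v) = Fin.inject₁ v
    , trans (cong (pathAdj (suc (toℕ v))) (toℕ-inject₁ v)) (trans (pathAdj-sym (suc (toℕ v)) (toℕ v)) (pathAdj-suc (toℕ v)))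

  P∪K₁≇P : ∀ {k} → 1 ≤ k → ¬ (P∪K₁ k ≅G P (suc k))
  P∪K₁≇P {suc k} _ φ = ℕ.0≢1+n (begin
    0                                 ≡⟨ to-adj φ Fin.zero (from φ w) ⟩
    pathAdj u (toℕ (to φ (from φ w))) ≡⟨ cong (pathAdj u ∘ toℕ) (to-from φ w) ⟩
    pathAdj u (toℕ w)                 ≡⟨ w-adj ⟩
    1                                 ∎)
    where
    open ≡-Reasoning
    u = toℕ (to φ Fin.zero)
    w = proj₁ (path-neighbour {k} (to φ Fin.zero))
    w-adj = proj₂ (path-neighbour {k} (to φ Fin.zero))

  Inside : ℕ → ℕ → ℕ → Set
  Inside a k x = a ≤ x × x < a + k

  Covers : ∀ {n} → (Fin n → ℕ) → ℕ → ℕ → Set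
  Covers h a k = ∀ s → s < k → ∃ λ t → h t ≡ a + s

  covers-∘ : ∀ {m n} {h : Fin n → ℕ} {g : Fin m → Fin n} {a k} → Covers (h ∘ g) a k → Covers h a k
  covers-∘ {g = g} cov s s<k = let (t , ht) = cov s s<k in g t , ht

  covers-≤ : ∀ {n} {h : Fin n → ℕ} {a k K} → k ≤ K → Covers h a K → Covers h a k
  covers-≤ k≤K cov s s<k = cov s (ℕ.<-≤-trans s<k k≤K)

  covers-extendʳ : ∀ {n} {h : Fin n → ℕ} {a k} v → h v ≡ a + k → Covers h a k → Covers h a (suc k)
  covers-extendʳ v hv cov s s<1+k with ℕ.m<1+n⇒m<n∨m≡n s<1+k
  ... | inj₁ s<k = cov s s<k
  ... | inj₂ refl = v , hv

  covers-extendˡ : ∀ {n} {h : Fin n → ℕ} {a k} v → suc (h v) ≡ a → Covers h a k → Covers h (h v) (suc k)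
  covers-extendˡ v hv cov zero _ = v , sym (ℕ.+-identityʳ _)
  covers-extendˡ {h = h} v hv cov (suc s) (s≤s s<k) =
    let (t , ht) = cov s s<k in t , trans ht (trans (cong (_+ s) (sym hv)) (sym (ℕ.+-suc (h v) s)))

  covers-inside : ∀ {n} {h : Fin n → ℕ} {a k x} → Covers h a k → Inside a k x → ∃ λ t → h t ≡ x
  covers-inside {a = a} {k} {x} cov (a≤x , x<a+k) =
    let (t , ht) = cov (x ∸ a) (ℕ.+-cancelˡ-< a (x ∸ a) k (subst (_< a + k) (sym x≡) x<a+k))
    in t , trans ht x≡
    where x≡ = ℕ.m+[n∸m]≡n a≤x

  adjacent-outside : ∀ {a k x y} → ¬ Inside a k x → Inside a k y → pathAdj x y ≡ 1 → suc x ≡ a ⊎ x ≡ a + k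
  adjacent-outside {a} {k} {x} {y} x∉ (a≤y , y<a+k) xy with pathAdj≡1 x y xy
  ... | inj₁ refl = inj₁ (ℕ.≤-antisym (ℕ.≮⇒≥ (λ a<1+x → x∉ (ℕ.≤-pred a<1+x , ℕ.<-trans (ℕ.n<1+n x) y<a+k))) a≤y)
  ... | inj₂ refl = inj₂ (ℕ.≤-antisym y<a+k (ℕ.≮⇒≥ (λ x<a+k → x∉ (ℕ.m≤n⇒m≤1+n a≤y , x<a+k))))

  Apart : ℕ → ℕ → ℕ → Set
  Apart b a k = suc b < a ⊎ a + k < b

  outside⇒apart : ∀ {a k b} → ¬ Inside a k b → suc b ≢ a → b ≢ a + k → Apart b a k
  outside⇒apart {a} {k} {b} b∉ b+1≢a b≢a+k with b ℕ.<? a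
  ... | yes b<a = inj₁ (ℕ.≤∧≢⇒< b<a b+1≢a)
  ... | no b≮a = inj₂ (ℕ.≤∧≢⇒< (ℕ.≮⇒≥ (λ b<a+k → b∉ (ℕ.≮⇒≥ b≮a , b<a+k))) (b≢a+k ∘ sym))

  apart⇒far : ∀ {a k b s} → Apart b a k → s < k → suc b < a + s ⊎ suc (a + s) < b
  apart⇒far {a} {s = s} (inj₁ b+1<a) _ = inj₁ (ℕ.<-≤-trans b+1<a (ℕ.m≤m+n a s))
  apart⇒far {a} {k} {s = s} (inj₂ a+k<b) s<k =
    inj₂ (ℕ.≤-<-trans (subst (_≤ a + k) (ℕ.+-suc a s) (ℕ.+-monoʳ-≤ a s<k)) a+k<b)

  -- Without vertex 0 the image is an interval by induction; the image of vertex 0 lies outside it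
  -- and next to the image of vertex 1, so it extends the interval at one end.
  path-image-interval : ∀ {k} (h : Fin k → ℕ) → Injective _≡_ _≡_ h
                      → (∀ i j → pathAdj (h i) (h j) ≡ pathAdj (toℕ i) (toℕ j))
                      → ∃ λ a → (∀ t → Inside a k (h t)) × Covers h a k
  path-image-interval {zero} h _ _ = 0 , (λ ()) , (λ _ ())
  path-image-interval {suc zero} h _ _ =
    h Fin.zero , (λ { Fin.zero → ℕ.≤-refl , ℕ.m<m+n (h Fin.zero) (s≤s z≤n) })
    , λ { zero _ → Fin.zero , sym (ℕ.+-identityʳ _) ; (suc s) (s≤s ()) }
  path-image-interval {suc (suc k)} h h-inj h-adj
    with path-image-interval (h ∘ Fin.suc) (suc-injective ∘ h-inj) (λ i j → h-adj (Fin.suc i) (Fin.suc j))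
  ... | a , inside , cov = extend (adjacent-outside h₀-outside (inside Fin.zero) (h-adj Fin.zero (Fin.suc Fin.zero)))
    where
    h₀ = h Fin.zero
    h₀-outside : ¬ Inside a (suc k) h₀
    h₀-outside h₀∈ = let (t , ht) = covers-inside cov h₀∈ in 0≢1+n (h-inj (sym ht))
    extend : suc h₀ ≡ a ⊎ h₀ ≡ a + suc k
           → ∃ λ a′ → (∀ t → Inside a′ (suc (suc k)) (h t)) × Covers h a′ (suc (suc k))
    extend (inj₁ left) = h₀ , inside-left , covers-extendˡ Fin.zero left (covers-∘ cov)
      where
      inside-left : ∀ t → Inside h₀ (suc (suc k)) (h t)
      inside-left Fin.zero = ℕ.≤-refl , ℕ.m<m+n h₀ (s≤s z≤n)
      inside-left (Fin.suc t) =
          ℕ.≤-trans (ℕ.n≤1+n h₀) (subst (_≤ h (Fin.suc t)) (sym left) (proj₁ (inside t)))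
        , subst (h (Fin.suc t) <_) (trans (cong (_+ suc k) (sym left)) (sym (ℕ.+-suc h₀ (suc k)))) (proj₂ (inside t))
    extend (inj₂ right) = a , inside-right , covers-extendʳ Fin.zero right (covers-∘ cov)
      where
      inside-right : ∀ t → Inside a (suc (suc k)) (h t)
      inside-right Fin.zero =
        subst (a ≤_) (sym right) (ℕ.m≤m+n a (suc k)) , subst (_< a + suc (suc k)) (sym right) (ℕ.+-monoʳ-< a ℕ.≤-refl)
      inside-right (Fin.suc t) = proj₁ (inside t) , ℕ.<-trans (proj₂ (inside t)) (ℕ.+-monoʳ-< a ℕ.≤-refl)

  far⇒≢ : ∀ {x y} → suc x < y ⊎ suc y < x → x ≢ y
  far⇒≢ (inj₁ x+1<y) refl = ℕ.<-irrefl refl (ℕ.<-trans (ℕ.n<1+n _) x+1<y)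
  far⇒≢ (inj₂ y+1<x) refl = ℕ.<-irrefl refl (ℕ.<-trans (ℕ.n<1+n _) y+1<x)

  far⇒pathAdj≡0 : ∀ {x y} → suc x < y ⊎ suc y < x → pathAdj x y ≡ 0
  far⇒pathAdj≡0 (inj₁ x+1<y) = pathAdj-far x+1<y
  far⇒pathAdj≡0 {x} {y} (inj₂ y+1<x) = trans (pathAdj-sym x y) (pathAdj-far y+1<x)

  injective-into-interval⇒≤ : ∀ {n a k} (h : Fin n → ℕ) → Injective _≡_ _≡_ h → (∀ t → Inside a k (h t)) → n ≤ k
  injective-into-interval⇒≤ {a = a} {k} h h-inj inside = injective⇒≤ {f = offset} offset-inj
    where
    offset<k : ∀ t → h t ∸ a < k
    offset<k t = let (a≤ , <a+k) = inside t in
      ℕ.+-cancelˡ-< a (h t ∸ a) k (subst (_< a + k) (sym (ℕ.m+[n∸m]≡n a≤)) <a+k)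
    offset : _ → Fin k
    offset t = Fin.fromℕ< (offset<k t)
    offset-inj : Injective _≡_ _≡_ offset
    offset-inj {x} {y} e = h-inj (begin
      h x             ≡⟨ sym (ℕ.m+[n∸m]≡n (proj₁ (inside x))) ⟩
      a + (h x ∸ a)   ≡⟨ cong (a +_) (trans (sym (toℕ-fromℕ< (offset<k x))) (trans (cong toℕ e) (toℕ-fromℕ< (offset<k y)))) ⟩
      a + (h y ∸ a)   ≡⟨ ℕ.m+[n∸m]≡n (proj₁ (inside y)) ⟩
      h y             ∎)
      where open ≡-Reasoning

  module BelowPath {c : Graph} {N : ℕ} (e : c ≤G P N) where

    pos : Fin (size c) → ℕ
    pos = toℕ ∘ emb e

    pos-injective : Injective _≡_ _≡_ pos
    pos-injective = emb-inj e ∘ toℕ-injective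

    module Run {a k : ℕ} (cov : Covers pos a k) where

      vertex : Fin k → Fin (size c)
      vertex t = proj₁ (cov (toℕ t) (toℕ<n t))

      vertex-pos : ∀ t → pos (vertex t) ≡ a + toℕ t
      vertex-pos t = proj₂ (cov (toℕ t) (toℕ<n t))

      vertex-injective : Injective _≡_ _≡_ vertex
      vertex-injective {x} {y} e = toℕ-injective (ℕ.+-cancelˡ-≡ a _ _
        (trans (sym (vertex-pos x)) (trans (cong pos e) (vertex-pos y))))

      vertex-adj : ∀ i j → pathAdj (toℕ i) (toℕ j) ≡ adj c (vertex i) (vertex j)
      vertex-adj i j = sym (trans (emb-adj e _ _) (trans (cong₂ pathAdj (vertex-pos i) (vertex-pos j)) (pathAdj-shift a _ _)))

    covers⇒P≤ : ∀ {a k} → Covers pos a k → P k ≤G c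
    covers⇒P≤ cov = record { emb = vertex ; emb-inj = vertex-injective ; emb-adj = vertex-adj }
      where open Run cov

    P≤⇒covers : ∀ {k} (p : P k ≤G c) → ∃ λ a → Covers (pos ∘ emb p) a k
    P≤⇒covers p =
      let (a , _ , cov) = path-image-interval (pos ∘ emb p) (emb-inj p ∘ pos-injective)
                                              (λ i j → sym (trans (emb-adj p i j) (emb-adj e _ _)))
      in a , cov

    separated⇒P∪K₁≤ : ∀ {a k} → Covers pos a k → ∀ v → Apart (pos v) a k → P∪K₁ k ≤G c
    separated⇒P∪K₁≤ {a} {k} cov v apart = record { emb = f ; emb-inj = f-inj ; emb-adj = f-adj }
      where
      open Run cov
      far : ∀ t → suc (pos v) < a + toℕ t ⊎ suc (a + toℕ t) < pos v
      far t = apart⇒far apart (toℕ<n t)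
      apart-from-run : ∀ t → pathAdj (pos v) (pos (vertex t)) ≡ 0
      apart-from-run t = trans (cong (pathAdj (pos v)) (vertex-pos t)) (far⇒pathAdj≡0 (far t))
      f : Fin (suc k) → Fin (size c)
      f Fin.zero = v
      f (Fin.suc t) = vertex t
      f-inj : Injective _≡_ _≡_ f
      f-inj {Fin.zero} {Fin.zero} _ = refl
      f-inj {Fin.zero} {Fin.suc t} v≡ = contradiction (trans (cong pos v≡) (vertex-pos t)) (far⇒≢ (far t))
      f-inj {Fin.suc t} {Fin.zero} ≡v = contradiction (trans (cong pos (sym ≡v)) (vertex-pos t)) (far⇒≢ (far t))
      f-inj {Fin.suc x} {Fin.suc y} e = cong Fin.suc (vertex-injective e)
      f-adj : ∀ i j → adj (P∪K₁ k) i j ≡ adj c (f i) (f j)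
      f-adj Fin.zero Fin.zero = sym (trans (emb-adj e v v) (pathAdj-diag (pos v)))
      f-adj Fin.zero (Fin.suc t) = sym (trans (emb-adj e _ _) (apart-from-run t))
      f-adj (Fin.suc t) Fin.zero = sym (trans (emb-adj e _ _) (trans (pathAdj-sym (pos (vertex t)) (pos v)) (apart-from-run t)))
      f-adj (Fin.suc i) (Fin.suc j) = vertex-adj i j

    P∪K₁≤⇒separated : ∀ {k} → 1 ≤ k → (q : P∪K₁ k ≤G c)
                     → ∃ λ a → Covers pos a k × Apart (pos (emb q Fin.zero)) a k
    P∪K₁≤⇒separated {suc k} _ q = a , covers-∘ {g = path} cov , outside⇒apart b-outside b+1≢a b≢a+k
      where
      path = emb q ∘ Fin.suc
      a = proj₁ (P≤⇒covers (≤G-trans (P≤P∪K₁ (suc k)) q))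
      cov : Covers (pos ∘ path) a (suc k)
      cov = proj₂ (P≤⇒covers (≤G-trans (P≤P∪K₁ (suc k)) q))
      b = pos (emb q Fin.zero)
      isolated : ∀ t → pathAdj b (pos (path t)) ≡ 0
      isolated t = trans (sym (emb-adj e _ _)) (sym (emb-adj q Fin.zero (Fin.suc t)))
      b-outside : ¬ Inside a (suc k) b
      b-outside b∈ = let (t , bt) = covers-inside cov b∈ in
        0≢1+n (emb-inj q (pos-injective (sym bt)))
      b+1≢a : suc b ≢ a
      b+1≢a b+1≡a = let (t , bt) = cov 0 (s≤s z≤n) in ℕ.0≢1+n (begin
        0                        ≡⟨ sym (isolated t) ⟩
        pathAdj b (pos (path t)) ≡⟨ cong (pathAdj b) (trans bt (trans (ℕ.+-identityʳ a) (sym b+1≡a))) ⟩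
        pathAdj b (suc b)        ≡⟨ pathAdj-suc b ⟩
        1                        ∎)
        where open ≡-Reasoning
      b≢a+k : b ≢ a + suc k
      b≢a+k b≡a+1+k = let (t , bt) = cov k ℕ.≤-refl in ℕ.0≢1+n (begin
        0                             ≡⟨ sym (isolated t) ⟩
        pathAdj b (pos (path t))      ≡⟨ cong₂ pathAdj (trans b≡a+1+k (ℕ.+-suc a k)) bt ⟩
        pathAdj (suc (a + k)) (a + k) ≡⟨ pathAdj-sym (suc (a + k)) (a + k) ⟩
        pathAdj (a + k) (suc (a + k)) ≡⟨ pathAdj-suc (a + k) ⟩
        1                             ∎)
        where open ≡-Reasoning

  P∪K₁≤P⇒2+k≤n : ∀ {k n} → 1 ≤ k → P∪K₁ k ≤G P n → 2 + k ≤ n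
  P∪K₁≤P⇒2+k≤n {suc k} {n} 1≤k q with BelowPath.P∪K₁≤⇒separated (≤G-refl (P n)) 1≤k q
  ... | a , cov , apart = fits apart
    where
    open ℕ.≤-Reasoning
    b<n : toℕ (emb q Fin.zero) < n
    b<n = toℕ<n _
    a+k<n : a + k < n
    a+k<n = let (t , at) = cov k ℕ.≤-refl in subst (_< n) at (toℕ<n t)
    fits : Apart (toℕ (emb q Fin.zero)) a (suc k) → 3 + k ≤ n
    fits (inj₁ b+1<a) = begin
      3 + k       ≤⟨ s≤s (ℕ.+-monoˡ-≤ k (ℕ.≤-trans (s≤s (s≤s z≤n)) b+1<a)) ⟩
      suc (a + k) ≤⟨ a+k<n ⟩
      n           ∎
    fits (inj₂ a+k+1<b) = begin
      3 + k                      ≤⟨ s≤s (s≤s (ℕ.m≤n+m (suc k) a)) ⟩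
      2 + (a + suc k)            ≤⟨ s≤s a+k+1<b ⟩
      suc (toℕ (emb q Fin.zero)) ≤⟨ b<n ⟩
      n                          ∎

  IsLongestPath : Graph → ℕ → Set
  IsLongestPath c M = P M ≤G c × (∀ k → P k ≤G c → k ≤ M)

  longestPath : ∀ c → ∃ (IsLongestPath c)
  longestPath c = search (size c) (λ _ → size-mono)
    where
    search : ∀ n → (∀ k → P k ≤G c → k ≤ n) → ∃ (IsLongestPath c)
    search n bound with P n ≤G? c
    ... | yes Pn≤c = n , Pn≤c , bound
    search zero bound | no P0≰c = contradiction (P0≤ c) P0≰c
    search (suc n) bound | no Pn≰c =
      search n (λ k Pk≤c → ℕ.≤-pred (ℕ.≤∧≢⇒< (bound k Pk≤c) λ { refl → Pn≰c Pk≤c }))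

  module LongestPath {c : Graph} {N : ℕ} (e : c ≤G P N) {M : ℕ} (longest : IsLongestPath c M) where
    open BelowPath e

    ≤M⇒P≤ : ∀ {k} → k ≤ M → P k ≤G c
    ≤M⇒P≤ k≤M = ≤G-trans (P-mono k≤M) (proj₁ longest)

    P≤⇒≤M : ∀ {k} → P k ≤G c → k ≤ M
    P≤⇒≤M = proj₂ longest _

    M≤size : M ≤ size c
    M≤size = size-mono (proj₁ longest)

    2+k≤M⇒P∪K₁≤ : ∀ {k} → 2 + k ≤ M → P∪K₁ k ≤G c
    2+k≤M⇒P∪K₁≤ {k} 2+k≤M = ≤G-trans (P∪K₁≤P k) (≤M⇒P≤ 2+k≤M)

    -- Some vertex lies off a longest run; by maximality it is not next to either end of the run,
    -- so together with an initial segment of the run it spans P∪K₁ k.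
    M<size⇒P∪K₁≤ : ∀ {k} → M < size c → k ≤ M → P∪K₁ k ≤G c
    M<size⇒P∪K₁≤ {k} M<size k≤M =
      separated⇒P∪K₁≤ (covers-≤ k≤M cov) v (shrink (outside⇒apart v-outside v+1≢a v≢a+M))
      where
      a = proj₁ (P≤⇒covers (proj₁ longest))
      cov : Covers pos a M
      cov = covers-∘ (proj₂ (P≤⇒covers (proj₁ longest)))
      outside = ¬∀⟶∃¬ (size c) (λ v → Inside a M (pos v)) (λ v → a ℕ.≤? pos v ×-dec pos v ℕ.<? a + M)
                      (λ all-inside → ℕ.<⇒≱ M<size (injective-into-interval⇒≤ pos pos-injective all-inside))
      v = proj₁ outside
      v-outside = proj₂ outside
      v+1≢a : suc (pos v) ≢ a
      v+1≢a v+1≡a = ℕ.1+n≰n (P≤⇒≤M (covers⇒P≤ (covers-extendˡ v v+1≡a cov)))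
      v≢a+M : pos v ≢ a + M
      v≢a+M v≡a+M = ℕ.1+n≰n (P≤⇒≤M (covers⇒P≤ (covers-extendʳ v v≡a+M cov)))
      shrink : Apart (pos v) a M → Apart (pos v) a k
      shrink (inj₁ v+1<a) = inj₁ v+1<a
      shrink (inj₂ a+M<v) = inj₂ (ℕ.≤-<-trans (ℕ.+-monoʳ-≤ a k≤M) a+M<v)

    P∪K₁≤⇒2+k≤M∨M<size : ∀ {k} → 1 ≤ k → P∪K₁ k ≤G c → 2 + k ≤ M ⊎ (M < size c × k ≤ M)
    P∪K₁≤⇒2+k≤M∨M<size {k} 1≤k q with ℕ.m≤n⇒m<n∨m≡n M≤size
    ... | inj₁ M<size = inj₂ (M<size , P≤⇒≤M (≤G-trans (P≤P∪K₁ k) q))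
    ... | inj₂ M≡size = inj₁ (P∪K₁≤P⇒2+k≤n 1≤k (≤G-trans q (≅G⇒≤G c≅PM)))
      where c≅PM = ≅G-sym (≤G∧size≡⇒≅G (proj₁ longest) M≡size)

open Paths

open import Data.Integer using (_+_; _*_; _-_; -_)

𝟙 : ∀ {A : Set} → Dec A → ℤ
𝟙 (yes _) = 1ℤ
𝟙 (no _) = 0ℤ

𝟙-yes : ∀ {A : Set} (A? : Dec A) → A → 𝟙 A? ≡ 1ℤ
𝟙-yes (yes _) _ = refl
𝟙-yes (no ¬a) a = contradiction a ¬a

𝟙-no : ∀ {A : Set} (A? : Dec A) → ¬ A → 𝟙 A? ≡ 0ℤ
𝟙-no (yes a) ¬a = contradiction a ¬a
𝟙-no (no _) _ = refl

𝟙-⇔ : ∀ {A B : Set} (A? : Dec A) (B? : Dec B) → (A → B) → (B → A) → 𝟙 A? ≡ 𝟙 B?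
𝟙-⇔ (yes a) B? to _ = sym (𝟙-yes B? (to a))
𝟙-⇔ (no ¬a) B? _ from = sym (𝟙-no B? (¬a ∘ from))

𝟙-⊎ : ∀ {A B C : Set} (A? : Dec A) (B? : Dec B) (C? : Dec C)
    → (A → ¬ B) → (A ⊎ B → C) → (C → A ⊎ B) → 𝟙 A? + 𝟙 B? ≡ 𝟙 C?
𝟙-⊎ (yes a) (yes b) C? disjoint _ _ = contradiction b (disjoint a)
𝟙-⊎ (yes a) (no _) C? _ into _ = sym (𝟙-yes C? (into (inj₁ a)))
𝟙-⊎ (no _) (yes b) C? _ into _ = sym (𝟙-yes C? (into (inj₂ b)))
𝟙-⊎ (no ¬a) (no ¬b) C? _ _ split = sym (𝟙-no C? (Sum.[ ¬a , ¬b ]′ ∘ split))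

sumOver : ∀ {A : Set} → List A → (A → ℤ) → ℤ
sumOver L f = foldr _+_ 0ℤ (map f L)

sumOver-cong : ∀ {A : Set} (L : List A) {f g : A → ℤ} → (∀ {x} → x ∈ L → f x ≡ g x) → sumOver L f ≡ sumOver L g
sumOver-cong [] _ = refl
sumOver-cong (x ∷ L) f≡g = cong₂ _+_ (f≡g (here refl)) (sumOver-cong L (f≡g ∘ there))

sumOver-scale : ∀ {A : Set} (L : List A) w (f : A → ℤ) → sumOver L (λ x → w * f x) ≡ w * sumOver L f
sumOver-scale [] w f = sym (ℤ.*-zeroʳ w)
sumOver-scale (x ∷ L) w f = trans (cong (w * f x +_) (sumOver-scale L w f)) (sym (ℤ.*-distribˡ-+ w (f x) _))

sumOver-− : ∀ {A : Set} (L : List A) (f g : A → ℤ) → sumOver L (λ x → f x - g x) ≡ sumOver L f - sumOver L g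
sumOver-− [] f g = refl
sumOver-− (x ∷ L) f g = trans (cong (f x - g x +_) (sumOver-− L f g)) (swap (f x) (g x) (sumOver L f) (sumOver L g))
  where
  swap : ∀ a b c d → a - b + (c - d) ≡ a + c - (b + d)
  swap = solve-∀

sumOver-∑-comm : ∀ {A : Set} (L : List A) {n} (f : A → Fin n → ℤ)
               → sumOver L (λ x → sum (f x)) ≡ sum (λ i → sumOver L (λ x → f x i))
sumOver-∑-comm [] {n} f = sym (sum-replicate-zero n)
sumOver-∑-comm (x ∷ L) f = trans (cong (sum (f x) +_) (sumOver-∑-comm L f)) (sym (∑-distrib-+ (f x) _))

∑-zero : ∀ {n} {f : Fin n → ℤ} → (∀ i → f i ≡ 0ℤ) → sum f ≡ 0ℤ
∑-zero {n} f≡0 = trans (sum-cong-≗ f≡0) (sum-replicate-zero n)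

∑-sift : ∀ X (f : ℕ → ℤ) {j} → j ≤ X → (∀ i → i ≢ j → f i ≡ 0ℤ) → ∑[ i ≤ X ] f (toℕ i) ≡ f j
∑-sift zero f z≤n _ = ℤ.+-identityʳ (f 0)
∑-sift (suc X) f {zero} _ vanish =
  trans (cong (f 0 +_) (∑-zero {suc X} (λ i → vanish (suc (toℕ i)) λ ()))) (ℤ.+-identityʳ (f 0))
∑-sift (suc X) f {suc j} (s≤s j≤X) vanish =
  trans (cong₂ _+_ (vanish 0 λ ()) (∑-sift X (f ∘ suc) j≤X (λ i i≢j → vanish (suc i) (i≢j ∘ ℕ.suc-injective))))
        (ℤ.+-identityˡ (f (suc j)))

alternating : ℕ → (ℕ → ℤ) → ℤ
alternating X f = ∑[ i ≤ X ] (-1ℤ ^ toℕ i * f (toℕ i))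

alternating-cong : ∀ X {f g : ℕ → ℤ} → (∀ i → f i ≡ g i) → alternating X f ≡ alternating X g
alternating-cong X f≡g = sum-cong-≗ {suc X} (λ i → cong (-1ℤ ^ toℕ i *_) (f≡g (toℕ i)))

alternating-+ : ∀ X (f g : ℕ → ℤ) → alternating X f + alternating X g ≡ alternating X (λ i → f i + g i)
alternating-+ X f g = trans (sym (∑-distrib-+ {suc X} (λ i → -1ℤ ^ toℕ i * f (toℕ i)) (λ i → -1ℤ ^ toℕ i * g (toℕ i))))
  (sum-cong-≗ {suc X} (λ i → sym (ℤ.*-distribˡ-+ (-1ℤ ^ toℕ i) (f (toℕ i)) (g (toℕ i)))))

alternating-zero : ∀ X {f : ℕ → ℤ} → (∀ i → f i ≡ 0ℤ) → alternating X f ≡ 0ℤ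
alternating-zero X f≡0 = ∑-zero {suc X} (λ i → trans (cong (-1ℤ ^ toℕ i *_) (f≡0 (toℕ i))) (ℤ.*-zeroʳ (-1ℤ ^ toℕ i)))

alternating-δ : ∀ X {j} → j ≤ X → alternating X (λ i → 𝟙 (i ℕ.≟ j)) ≡ -1ℤ ^ j
alternating-δ X {j} j≤X = trans
  (∑-sift X (λ i → -1ℤ ^ i * 𝟙 (i ℕ.≟ j)) j≤X
    (λ i i≢j → trans (cong (-1ℤ ^ i *_) (𝟙-no (i ℕ.≟ j) i≢j)) (ℤ.*-zeroʳ (-1ℤ ^ i))))
  (trans (cong (-1ℤ ^ j *_) (𝟙-yes (j ℕ.≟ j) refl)) (ℤ.*-identityʳ (-1ℤ ^ j)))

alternating-adjacent : ∀ X {j} → suc j ≤ X → alternating X (λ i → 𝟙 (i ℕ.≟ j) + 𝟙 (i ℕ.≟ suc j)) ≡ 0ℤ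
alternating-adjacent X {j} 1+j≤X = begin
  alternating X (λ i → 𝟙 (i ℕ.≟ j) + 𝟙 (i ℕ.≟ suc j))
    ≡⟨ alternating-+ X (λ i → 𝟙 (i ℕ.≟ j)) (λ i → 𝟙 (i ℕ.≟ suc j)) ⟨
  alternating X (λ i → 𝟙 (i ℕ.≟ j)) + alternating X (λ i → 𝟙 (i ℕ.≟ suc j))
    ≡⟨ cong₂ _+_ (alternating-δ X (ℕ.<⇒≤ 1+j≤X)) (alternating-δ X 1+j≤X) ⟩
  -1ℤ ^ j + -1ℤ * -1ℤ ^ j
    ≡⟨ cong (-1ℤ ^ j +_) (ℤ.-1*i≡-i (-1ℤ ^ j)) ⟩
  -1ℤ ^ j - -1ℤ ^ j
    ≡⟨ ℤ.+-inverseʳ (-1ℤ ^ j) ⟩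
  0ℤ ∎
  where open ≡-Reasoning

sumOver-alternating : ∀ {A : Set} (L : List A) X (F : A → ℕ → ℤ)
                    → sumOver L (λ x → alternating X (F x)) ≡ alternating X (λ i → sumOver L (λ x → F x i))
sumOver-alternating L X F =
  trans (sumOver-∑-comm L {suc X} (λ x i → -1ℤ ^ toℕ i * F x (toℕ i)))
        (sum-cong-≗ {suc X} (λ i → sumOver-scale L (-1ℤ ^ toℕ i) (λ x → F x (toℕ i))))

count-≅G : ∀ (R : Graph) {L} → AllPairs (λ d e → ¬ (d ≅G e)) L
          → sumOver L (λ c → 𝟙 (c ≅G? R)) ≡ 𝟙 (Any.any? (R ≅G?_) L)
count-≅G R [] = refl
count-≅G R {x ∷ L} (x≇L ∷ distinct) =
  trans (cong (𝟙 (x ≅G? R) +_) (count-≅G R distinct))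
        (𝟙-⊎ (x ≅G? R) (Any.any? (R ≅G?_) L) (Any.any? (R ≅G?_) (x ∷ L)) disjoint into split)
  where
  disjoint : x ≅G R → ¬ Any (R ≅G_) L
  disjoint x≅R = All.lookupWith (λ x≇y R≅y → x≇y (≅G-trans x≅R R≅y)) x≇L
  into : x ≅G R ⊎ Any (R ≅G_) L → Any (R ≅G_) (x ∷ L)
  into (inj₁ x≅R) = here (≅G-sym x≅R)
  into (inj₂ found) = there found
  split : Any (R ≅G_) (x ∷ L) → x ≅G R ⊎ Any (R ≅G_) L
  split (here R≅x) = inj₁ (≅G-sym R≅x)
  split (there found) = inj₂ found

count-≅G-reps : ∀ {a b L} → IsIntervalReps a b L → ∀ R → sumOver L (λ c → 𝟙 (c ≅G? R)) ≡ 𝟙 (inInterval? a b R)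
count-≅G-reps {a} {b} {L} (inside , cover , distinct) R =
  trans (count-≅G R distinct) (𝟙-⇔ (Any.any? (R ≅G?_) L) (inInterval? a b R) represented (λ (a≤R , R<b) → cover R a≤R R<b))
  where
  represented : Any (R ≅G_) L → InInterval a b R
  represented found = let (c , c∈L , R≅c) = find found in InInterval-resp-≅G (≅G-sym R≅c) (inside c∈L)

interval-closure : ∀ {a b R} → a ≤G R → 𝟙 (inInterval? a b R) + 𝟙 (b ≅G? R) ≡ 𝟙 (R ≤G? b)
interval-closure {a} {b} {R} a≤R = 𝟙-⊎ (inInterval? a b R) (b ≅G? R) (R ≤G? b) disjoint into split
  where
  disjoint : InInterval a b R → ¬ (b ≅G R)
  disjoint (_ , _ , R≇b) = R≇b ∘ ≅G-sym
  into : InInterval a b R ⊎ b ≅G R → R ≤G b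
  into (inj₁ (_ , R≤b , _)) = R≤b
  into (inj₂ b≅R) = ≅G⇒≤G (≅G-sym b≅R)
  split : R ≤G b → InInterval a b R ⊎ b ≅G R
  split R≤b with b ≅G? R
  ... | yes b≅R = inj₂ b≅R
  ... | no b≇R = inj₁ (a≤R , R≤b , b≇R ∘ ≅G-sym)

module Mobius (μ : Graph → Graph → ℤ) (isMobius : IsMobius μ) (m : ℕ) (m>0 : 0 < m) (X : ℕ) where

  P[m+_] P∪K₁[m+_] : ℕ → Graph
  P[m+ i ] = P (m ℕ.+ i)
  P∪K₁[m+ i ] = P∪K₁ (m ℕ.+ i)

  Pm≤P[m+_] : ∀ i → P m ≤G P[m+ i ]
  Pm≤P[m+ i ] = P-mono (ℕ.m≤m+n m i)

  Pm≤P∪K₁[m+_] : ∀ i → P m ≤G P∪K₁[m+ i ]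
  Pm≤P∪K₁[m+ i ] = ≤G-trans Pm≤P[m+ i ] (P≤P∪K₁ (m ℕ.+ i))

  isoTerm intervalTerm belowTerm : Graph → ℕ → ℤ
  isoTerm c i = 𝟙 (c ≅G? P[m+ i ]) - 𝟙 (c ≅G? P∪K₁[m+ i ])
  intervalTerm c i = 𝟙 (inInterval? (P m) c P[m+ i ]) - 𝟙 (inInterval? (P m) c P∪K₁[m+ i ])
  belowTerm c i = 𝟙 (P[m+ i ] ≤G? c) - 𝟙 (P∪K₁[m+ i ] ≤G? c)

  -- Only graphs of size at most X occur, so the range i ≤ X misses no term.
  predicted : Graph → ℤ
  predicted c = alternating X (isoTerm c)

  predicted-path : ∀ {c n} → c ≅G P n → m ≤ n → n ≤ X → predicted c ≡ -1ℤ ^ (n ∸ m)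
  predicted-path {c} {n} c≅Pn m≤n n≤X = trans (alternating-cong X δ) (alternating-δ X (ℕ.≤-trans (ℕ.m∸n≤m n m) n≤X))
    where
    size-c : size c ≡ n
    size-c = size-≅G c≅Pn
    only-n : ∀ i → 𝟙 (c ≅G? P[m+ i ]) ≡ 𝟙 (i ℕ.≟ n ∸ m)
    only-n i = 𝟙-⇔ (c ≅G? P[m+ i ]) (i ℕ.≟ n ∸ m)
      (λ c≅P → trans (sym (ℕ.m+n∸m≡n m i)) (cong (_∸ m) (trans (sym (size-≅G c≅P)) size-c)))
      (λ { refl → subst (λ k → c ≅G P k) (sym (ℕ.m+[n∸m]≡n m≤n)) c≅Pn })
    not-P∪K₁ : ∀ i → ¬ (c ≅G P∪K₁[m+ i ])
    not-P∪K₁ i c≅Q = P∪K₁≇P (ℕ.≤-trans m>0 (ℕ.m≤m+n m i))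
      (subst (λ k → P∪K₁[m+ i ] ≅G P k) (trans (sym size-c) (size-≅G c≅Q)) (≅G-trans (≅G-sym c≅Q) c≅Pn))
    δ : ∀ i → isoTerm c i ≡ 𝟙 (i ℕ.≟ n ∸ m)
    δ i = trans (cong₂ _-_ (only-n i) (𝟙-no (c ≅G? P∪K₁[m+ i ]) (not-P∪K₁ i))) (ℤ.+-identityʳ _)

  sumOver-reps : ∀ {c L} → IsIntervalReps (P m) c L → sumOver L predicted ≡ alternating X (intervalTerm c)
  sumOver-reps {c} {L} reps = trans (sumOver-alternating L X isoTerm) (alternating-cong X λ i → begin
    sumOver L (λ c′ → isoTerm c′ i)
      ≡⟨ sumOver-− L _ _ ⟩
    sumOver L (λ c′ → 𝟙 (c′ ≅G? P[m+ i ])) - sumOver L (λ c′ → 𝟙 (c′ ≅G? P∪K₁[m+ i ]))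
      ≡⟨ cong₂ _-_ (count-≅G-reps reps _) (count-≅G-reps reps _) ⟩
    intervalTerm c i ∎)
    where open ≡-Reasoning

  isoTerm+intervalTerm : ∀ c i → isoTerm c i + intervalTerm c i ≡ belowTerm c i
  isoTerm+intervalTerm c i =
    trans (rearrange (𝟙 (c ≅G? P[m+ i ])) (𝟙 (c ≅G? P∪K₁[m+ i ]))
                     (𝟙 (inInterval? (P m) c P[m+ i ])) (𝟙 (inInterval? (P m) c P∪K₁[m+ i ])))
          (cong₂ _-_ (interval-closure Pm≤P[m+ i ]) (interval-closure Pm≤P∪K₁[m+ i ]))
    where
    rearrange : ∀ x y u v → x - y + (u - v) ≡ u + x - (v + y)
    rearrange = solve-∀
  module Closed {c : Graph} (c≤PX : c ≤G P X) {M : ℕ} (longest : IsLongestPath c M) where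
    open LongestPath c≤PX longest

    closed-sum-nonpath : M < size c → alternating X (belowTerm c) ≡ 0ℤ
    closed-sum-nonpath M<size = alternating-zero X λ i →
      trans (cong (_- 𝟙 (P∪K₁[m+ i ] ≤G? c))
                  (𝟙-⇔ (P[m+ i ] ≤G? c) (P∪K₁[m+ i ] ≤G? c)
                       (λ Pi≤c → M<size⇒P∪K₁≤ M<size (P≤⇒≤M Pi≤c)) (≤G-trans (P≤P∪K₁ (m ℕ.+ i)))))
            (ℤ.+-inverseʳ (𝟙 (P∪K₁[m+ i ] ≤G? c)))

    module _ (m<M : m < M) (M≡size : M ≡ size c) where

      j : ℕ
      j = M ∸ suc m

      M≡m+1+j : M ≡ m ℕ.+ suc j
      M≡m+1+j = sym (trans (ℕ.+-suc m j) (ℕ.m+[n∸m]≡n m<M))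

      P[m+_]≤⇔ : ∀ i → (P[m+ i ] ≤G c → i ≤ suc j) × (i ≤ suc j → P[m+ i ] ≤G c)
      P[m+ i ]≤⇔ = (λ Pi≤c → ℕ.+-cancelˡ-≤ m i (suc j) (subst (m ℕ.+ i ≤_) M≡m+1+j (P≤⇒≤M Pi≤c)))
                 , (λ i≤ → ≤M⇒P≤ (subst (m ℕ.+ i ≤_) (sym M≡m+1+j) (ℕ.+-monoʳ-≤ m i≤)))

      P∪K₁[m+_]≤⇔ : ∀ i → (P∪K₁[m+ i ] ≤G c → i < j) × (i < j → P∪K₁[m+ i ] ≤G c)
      P∪K₁[m+ i ]≤⇔ = bound
        , (λ i<j → 2+k≤M⇒P∪K₁≤ (subst₂ _≤_ (sym 2+m+i≡) (sym M≡m+1+j) (ℕ.+-monoʳ-≤ m (s≤s i<j))))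
        where
        2+m+i≡ : 2 ℕ.+ (m ℕ.+ i) ≡ m ℕ.+ (2 ℕ.+ i)
        2+m+i≡ = sym (trans (ℕ.+-suc m (suc i)) (cong suc (ℕ.+-suc m i)))
        bound : P∪K₁[m+ i ] ≤G c → i < j
        bound q with P∪K₁≤⇒2+k≤M∨M<size (ℕ.≤-trans m>0 (ℕ.m≤m+n m i)) q
        ... | inj₁ long = ℕ.≤-pred (ℕ.+-cancelˡ-≤ m (2 ℕ.+ i) (suc j) (subst₂ _≤_ 2+m+i≡ M≡m+1+j long))
        ... | inj₂ (M<size , _) = contradiction M≡size (ℕ.<⇒≢ M<size)

      belowTerm-two-points : ∀ i → belowTerm c i ≡ 𝟙 (i ℕ.≟ j) + 𝟙 (i ℕ.≟ suc j)
      belowTerm-two-points i = begin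
        𝟙 A? - 𝟙 B?
          ≡⟨ cong (_- 𝟙 B?) (trans (cong (_+ 𝟙 (i ℕ.≟ suc j)) below-j) up-to-1+j) ⟨
        𝟙 B? + 𝟙 (i ℕ.≟ j) + 𝟙 (i ℕ.≟ suc j) - 𝟙 B?
          ≡⟨ cancel (𝟙 B?) _ _ ⟩
        𝟙 (i ℕ.≟ j) + 𝟙 (i ℕ.≟ suc j) ∎
        where
        open ≡-Reasoning
        A? = P[m+ i ] ≤G? c
        B? = P∪K₁[m+ i ] ≤G? c
        cancel : ∀ b x y → b + x + y - b ≡ x + y
        cancel = solve-∀
        below-j : 𝟙 B? + 𝟙 (i ℕ.≟ j) ≡ 𝟙 (i ℕ.≤? j)
        below-j = 𝟙-⊎ B? (i ℕ.≟ j) (i ℕ.≤? j)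
          (λ q → ℕ.<⇒≢ (proj₁ P∪K₁[m+ i ]≤⇔ q))
          (λ { (inj₁ q) → ℕ.<⇒≤ (proj₁ P∪K₁[m+ i ]≤⇔ q) ; (inj₂ refl) → ℕ.≤-refl })
          (λ i≤j → Sum.map₁ (proj₂ P∪K₁[m+ i ]≤⇔) (ℕ.m≤n⇒m<n∨m≡n i≤j))
        up-to-1+j : 𝟙 (i ℕ.≤? j) + 𝟙 (i ℕ.≟ suc j) ≡ 𝟙 A?
        up-to-1+j = 𝟙-⊎ (i ℕ.≤? j) (i ℕ.≟ suc j) A?
          (λ { i≤j refl → ℕ.1+n≰n i≤j })
          (λ { (inj₁ i≤j) → proj₂ P[m+ i ]≤⇔ (ℕ.m≤n⇒m≤1+n i≤j)
             ; (inj₂ refl) → proj₂ P[m+ i ]≤⇔ ℕ.≤-refl })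
          (λ Pi≤c → Sum.map₁ ℕ.≤-pred (ℕ.m≤n⇒m<n∨m≡n (proj₁ P[m+ i ]≤⇔ Pi≤c)))

      closed-sum-path : alternating X (belowTerm c) ≡ 0ℤ
      closed-sum-path = trans (alternating-cong X belowTerm-two-points) (alternating-adjacent X 1+j≤X)
        where
        1+j≤X : suc j ≤ X
        1+j≤X = begin
          suc j         ≤⟨ ℕ.m≤n+m (suc j) m ⟩
          m ℕ.+ suc j   ≡⟨ M≡m+1+j ⟨
          M             ≤⟨ M≤size ⟩
          size c        ≤⟨ size-mono c≤PX ⟩
          X             ∎
          where open ℕ.≤-Reasoning

  closed-sum : ∀ {c} → c ≤G P X → P m ≤G c → ¬ (P m ≅G c) → alternating X (belowTerm c) ≡ 0ℤ
  closed-sum {c} c≤PX Pm≤c Pm≇c with longestPath c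
  ... | M , longest with ℕ.m≤n⇒m<n∨m≡n (LongestPath.M≤size c≤PX longest)
  ...   | inj₁ M<size = Closed.closed-sum-nonpath c≤PX longest M<size
  ...   | inj₂ M≡size = Closed.closed-sum-path c≤PX longest (ℕ.≤∧≢⇒< m≤M m≢M) M≡size
    where
    m≤M : m ≤ M
    m≤M = LongestPath.P≤⇒≤M c≤PX longest Pm≤c
    m≢M : m ≢ M
    m≢M m≡M = Pm≇c (≤G∧size≡⇒≅G Pm≤c (trans m≡M M≡size))

  MatchesPrediction : Graph → Set
  MatchesPrediction c = c ≤G P X → P m ≤G c → μ (P m) c ≡ predicted c

  matchesPrediction : ∀ c → MatchesPrediction c
  matchesPrediction = WF.All.wfRec (On.wellFounded size ℕ.<-wellFounded) _ MatchesPrediction step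
    where
    step : ∀ c → (∀ {c′} → size c′ < size c → MatchesPrediction c′) → MatchesPrediction c
    step c IH c≤PX Pm≤c with P m ≅G? c
    ... | yes Pm≅c = begin
      μ (P m) c        ≡⟨ proj₁ isMobius (P m) c Pm≅c ⟩
      1ℤ               ≡⟨ cong (-1ℤ ^_) (ℕ.n∸n≡0 m) ⟨
      -1ℤ ^ (m ∸ m)    ≡⟨ predicted-path (≅G-sym Pm≅c) ℕ.≤-refl (size-mono (≤G-trans Pm≤c c≤PX)) ⟨
      predicted c      ∎
      where open ≡-Reasoning
    ... | no Pm≇c = begin
      μ (P m) c                         ≡⟨ proj₂ (proj₂ isMobius) (P m) c (Pm≤c , Pm≇c) L reps ⟩
      - sumOver L (μ (P m))             ≡⟨ cong -_ (sumOver-cong L by-induction) ⟩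
      - sumOver L predicted             ≡⟨ cong -_ (sumOver-reps reps) ⟩
      - alternating X (intervalTerm c)  ≡⟨ inverseˡ-unique (predicted c) (alternating X (intervalTerm c)) closes ⟨
      predicted c                       ∎
      where
      open ≡-Reasoning
      L = intervalReps (P m) c
      reps = intervalReps-correct (P m) c
      by-induction : ∀ {c′} → c′ ∈ L → μ (P m) c′ ≡ predicted c′
      by-induction c′∈L = let (Pm≤c′ , c′<c) = proj₁ reps c′∈L in
        IH (<G⇒size< c′<c) (≤G-trans (proj₁ c′<c) c≤PX) Pm≤c′
      closes : predicted c + alternating X (intervalTerm c) ≡ 0ℤ
      closes = begin
        predicted c + alternating X (intervalTerm c)               ≡⟨ alternating-+ X (isoTerm c) (intervalTerm c) ⟩
        alternating X (λ i → isoTerm c i + intervalTerm c i)       ≡⟨ alternating-cong X (isoTerm+intervalTerm c) ⟩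
        alternating X (belowTerm c)                                ≡⟨ closed-sum c≤PX Pm≤c Pm≇c ⟩
        0ℤ                                                         ∎

lemma4p3 : (μ : Graph → Graph → ℤ) → IsMobius μ →
    ∀ m x → 0 < m → m ≤ x → μ (P m) (P x) ≡ -1ℤ ^ (x ∸ m)
lemma4p3 μ isMobius m x m>0 m≤x =
  trans (matchesPrediction (P x) (≤G-refl (P x)) (P-mono m≤x)) (predicted-path (≅G-refl (P x)) m≤x ℕ.≤-refl)
  where open Mobius μ isMobius m m>0 x
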